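{- Let $K$ be a field, let $n$ be a nonnegative integer, let $a_1,\dots,a_n$ be indeterminates, and let $f_1(x),\dots,f_n(x)\in K[x]$ be polynomials in one variable whose coefficients do not depend on $a_1,\dots,a_n$. For variables $x_1,\dots,x_m$ let $W_m(x_1,\dots,x_m)$ denote the $n\times m$ matrix whose $(i,j)$-entry ($1\le i\le n$, $1\le j\le m$) is $$\partial_{x_{j-1},x_j}\cdots\partial_{x_2,x_3}\partial_{x_1,x_2}f_i(x_1)$$ (for $j=1$ this is just $f_i(x_1)$). Given a composition $n=m_1+\dots+m_\ell$ of $n$ into positive integers, there holds, as an identity of rational functions in $a_1,\dots,a_n$, \begin{multline*} \det_{1\le i,j\le n}\big(W_{m_1}(a_1,\dots,a_{m_1})\,W_{m_2}(a_{m_1+1},\dots,a_{m_1+m_2})\cdots W_{m_\ell}(a_{m_1+\dots+m_{\ell-1}+1},\dots,a_n)\big)\\ =\det_{1\le i,j\le n}\big(f_i(a_j)\big)\Big/\prod_{k=1}^{\ell}\ \prod_{m_1+\dots+m_{k-1}+1\le i<j\le m_1+\dots+m_k}(a_j-a_i), \end{multline*} where the matrix on the left is the $n\times n$ matrix obtained by placing the blocks $W_{m_1},\dots,W_{m_\ell}$ side by side.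
   Context: The divided difference $\partial_{x,y}$ is the linear operator acting on polynomials (or rational functions) in $x$ and $y$ (possibly depending on further variables) by $\partial_{x,y}f(x,y)=\dfrac{f(x,y)-f(y,x)}{x-y}$. In the iterated expression $\partial_{x_{j-1},x_j}\cdots\partial_{x_1,x_2}f_i(x_1)$ the operators are applied from right to left: first $\partial_{x_1,x_2}$ to $f_i(x_1)$, then $\partial_{x_2,x_3}$ to the result (regarded as a function of $x_2,x_3$, other variables fixed), etc. Empty products equal $1$. -}

module Defs where

open import Level using (Level; _⊔_) renaming (suc to lsuc)
open import Algebra.Bundles using (CommutativeRing)
open import Data.Bool using (Bool; true; false; if_then_else_; _∧_)
open import Data.Nat using (ℕ; zero; suc; _∸_; _<ᵇ_; _≤ᵇ_) renaming (_+_ to _+ℕ_)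
open import Data.Fin using (Fin; zero; suc; toℕ; punchIn)
open import Data.List using (List; []; _∷_; map; reverse; filterᵇ; allFin)
open import Function using (_∘_)

-- The inverse operation is total; its value
-- at 0 is unconstrained and is never used in the statement (all
-- denominators occurring there are nonzero).
record Field (c ℓ : Level) : Set (lsuc (c ⊔ ℓ)) where
  field
    commutativeRing : CommutativeRing c ℓ
  open CommutativeRing commutativeRing public
  field
    _⁻¹        : Carrier → Carrier
    0≉1        : 0# ≉ 1#
    ⁻¹-inverse : ∀ x → x ≉ 0# → x * (x ⁻¹) ≈ 1#

  infixl 7 _/_
  _/_ : Carrier → Carrier → Carrier
  x / y = x * (y ⁻¹)

-- Block structure of a composition n = m₁ + … + mₗ (given as a list of
-- parts): blockStart ms j is the (0-based) index of the first column of the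
-- block containing the (0-based) column j.
blockStart : List ℕ → ℕ → ℕ
blockStart []       j = 0
blockStart (m ∷ ms) j = if j <ᵇ m then 0 else m +ℕ blockStart ms (j ∸ m)

module FieldOps {c ℓ : Level} (F : Field c ℓ) where
  open Field F using (Carrier; _+_; _*_; -_; _-_; 0#; 1#; _/_)

  ΣF : ∀ {n} → (Fin n → Carrier) → Carrier
  ΣF {zero}  g = 0#
  ΣF {suc n} g = g zero + ΣF (g ∘ suc)

  ΠF : ∀ {n} → (Fin n → Carrier) → Carrier
  ΠF {zero}  g = 1#
  ΠF {suc n} g = g zero * ΠF (g ∘ suc)

  signed : ℕ → Carrier → Carrier
  signed zero    x = x
  signed (suc k) x = - signed k x

  det : ∀ n → (Fin n → Fin n → Carrier) → Carrier
  det zero    M = 1#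
  det (suc n) M =
    ΣF (λ j → signed (toℕ j) (M zero j * det n (λ i k → M (suc i) (punchIn j k))))

  -- Iterated divided difference  ∂_{x_{j-1},x_j} ⋯ ∂_{x_1,x_2} f(x_1)
  -- evaluated at points x_1,…,x_j.  Arguments: the function f, the last
  -- point x_j, and the earlier points in reverse order x_{j-1} ∷ … ∷ x_1.
  dd : (Carrier → Carrier) → Carrier → List Carrier → Carrier
  dd f x []         = f x
  dd f y (x ∷ rest) = (dd f x rest - dd f y rest) / (x - y)

-- Evaluation in L of a polynomial with coefficients in K
-- (coefficient list, constant term first), via φ : K → L.
module PolyEval {c₁ ℓ₁ c₂ ℓ₂ : Level} (K : Field c₁ ℓ₁) (L : Field c₂ ℓ₂)
                (φ : Field.Carrier K → Field.Carrier L) where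
  open Field L using (Carrier; _+_; _*_; _-_; 0#; 1#)
  open FieldOps L using (dd; ΠF)

  evalP : List (Field.Carrier K) → Carrier → Carrier
  evalP []       x = 0#
  evalP (k ∷ ks) x = φ k + x * evalP ks x

  -- the n×n matrix  W_{m₁}(a_1..a_{m₁}) ⋯ W_{mₗ}(…,a_n)  (blocks side by side):
  -- entry (i,j) is the divided difference of f_i at a_s,…,a_j where s is the
  -- first column of the block containing j.
  Wblock : ∀ n → List ℕ → (Fin n → List (Field.Carrier K)) → (Fin n → Carrier)
         → Fin n → Fin n → Carrier
  Wblock n ms f a i j =
    dd (evalP (f i)) (a j)
       (map a (reverse (filterᵇ (λ k → (blockStart ms (toℕ j) ≤ᵇ toℕ k) ∧ (toℕ k <ᵇ toℕ j))
                                (allFin n))))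

  Fmat : ∀ n → (Fin n → List (Field.Carrier K)) → (Fin n → Carrier)
       → Fin n → Fin n → Carrier
  Fmat n f a i j = evalP (f i) (a j)

  blockVandermonde : ∀ n → List ℕ → (Fin n → Carrier) → Carrier
  blockVandermonde n ms a =
    ΠF (λ j → ΠF (λ i →
      if (toℕ i <ᵇ toℕ j) ∧ (blockStart ms (toℕ j) ≤ᵇ toℕ i)
      then a j - a i else 1#))

module Submission where

-- Each entry ∂_{a_{j-1},a_j} ⋯ ∂_{a_s,a_{s+1}} f_i(a_s) of the block matrix is a linear
-- combination Σ_{s≤k≤j} c_{kj} f_i(a_k), and the coefficient of f_i(a_j) is
-- c_{jj} = 1 / ∏_{s≤k<j} (a_j − a_k).  So the block matrix is (f_i(a_j)) times an
-- upper triangular matrix with diagonal c_{jj}, and its determinant is det (f_i(a_j))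
-- times ∏_j c_{jj}, which is the reciprocal of the block Vandermonde product.

open import Defs
open import Level using (Level)
open import Data.Nat using (ℕ; _≤_)
open import Data.Fin using (Fin)
open import Data.List using (List)
open import Data.Nat.ListAction using (sum)
open import Data.List.Relation.Unary.All using (All)
open import Relation.Binary.PropositionalEquality using (_≡_)
open import Algebra.Morphism.Structures using (module RingMorphisms)

open import Data.Bool using (Bool; true; false; if_then_else_; _∧_)
open import Data.Bool.Properties using (T-∧; ∧-comm)
open import Data.Empty using (⊥-elim)
open import Data.Fin using (zero; suc; toℕ; fromℕ<; punchIn; punchOut; inject₁; _≟_)
import Data.Fin.Properties as Fin
open import Data.Fin.Properties
  using (punchInᵢ≢i; punchIn-punchOut; punchOut-punchIn; punchOut-cong; toℕ-inject₁; toℕ-injective)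
open import Data.List using (_∷_; [])
import Data.List as List
import Data.List.Properties as List
open import Data.List.Membership.Propositional using (_∈_; _∉_)
open import Data.List.Membership.Propositional.Properties using (∈-filter⁻)
open import Data.List.Relation.Unary.Any using (here; there)
import Data.List.Relation.Unary.Any.Properties as Any
open import Data.Nat as ℕ using (zero; suc; s≤s; _<_; _<ᵇ_; _≤ᵇ_)
import Data.Nat.Properties as ℕ
open import Data.Product using (_×_; _,_; proj₂)
open import Data.Sum using (_⊎_; inj₁; inj₂)
open import Data.Vec.Functional using (removeAt)
open import Function using (_∘_)
open import Function.Bundles using (Equivalence)
open import Relation.Binary.Definitions using (tri<; tri≈; tri>)
open import Relation.Binary.PropositionalEquality as ≡ using (_≢_; cong)
open import Relation.Nullary using (¬_; Dec; yes; no)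
open import Relation.Nullary.Decidable using (T?)

private
  variable
    n : ℕ

if-<ᵇ-true : ∀ {a} {A : Set a} {m k} {x y : A} → m < k → (if m <ᵇ k then x else y) ≡ x
if-<ᵇ-true {m = m} {k} m<k with m <ᵇ k | ℕ.<⇒<ᵇ m<k
... | true | _ = ≡.refl

if-<ᵇ-false : ∀ {a} {A : Set a} {m k} {x y : A} → ¬ m < k → (if m <ᵇ k then x else y) ≡ y
if-<ᵇ-false {m = m} {k} m≮k with m <ᵇ k | ℕ.<ᵇ⇒< m k
... | false | _  = ≡.refl
... | true  | lt = ⊥-elim (m≮k (lt _))

if-<ᵇ-suc : ∀ {a} {A : Set a} {l m} {x y : A} → l ≢ m →
            (if l <ᵇ m then x else y) ≡ (if l <ᵇ suc m then x else y)
if-<ᵇ-suc {l = l} {m} l≢m with ℕ.<-cmp l m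
... | tri< l<m _ _ = ≡.trans (if-<ᵇ-true l<m) (≡.sym (if-<ᵇ-true (ℕ.m<n⇒m<1+n l<m)))
... | tri≈ _ l≡m _ = ⊥-elim (l≢m l≡m)
... | tri> _ _ m<l = ≡.trans (if-<ᵇ-false (ℕ.<⇒≯ m<l)) (≡.sym (if-<ᵇ-false (ℕ.≤⇒≯ m<l)))

punchIn-≢ : ∀ {i j : Fin (suc n)} (i≢j : i ≢ j) k → k ≢ punchOut i≢j → punchIn i k ≢ j
punchIn-≢ {i = i} i≢j k k≢ eq = k≢ (≡.trans (≡.sym (punchOut-punchIn i)) (punchOut-cong i eq))

punchIn-adjacent : ∀ {j k : Fin (suc n)} → toℕ k ≡ suc (toℕ j) → ∀ c →
                   punchIn j c ≡ punchIn k c ⊎ (punchIn j c ≡ k × punchIn k c ≡ j)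
punchIn-adjacent {j = zero}  {suc zero}      _ zero    = inj₂ (≡.refl , ≡.refl)
punchIn-adjacent {j = zero}  {suc zero}      _ (suc c) = inj₁ ≡.refl
punchIn-adjacent {j = zero}  {suc (suc k)}   ()
punchIn-adjacent {j = suc j} {suc k}         _ zero    = inj₁ ≡.refl
punchIn-adjacent {j = suc j} {suc k}         k≡1+j (suc c)
  with punchIn-adjacent {j = j} {k} (ℕ.suc-injective k≡1+j) c
... | inj₁ eq         = inj₁ (cong suc eq)
... | inj₂ (eqj , eqk) = inj₂ (cong suc eqj , cong suc eqk)

punchIn-reflects-adjacent : ∀ (i : Fin (suc n)) c d →
                            toℕ (punchIn i d) ≡ suc (toℕ (punchIn i c)) → toℕ d ≡ suc (toℕ c)
punchIn-reflects-adjacent zero    c       d       eq = ℕ.suc-injective eq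
punchIn-reflects-adjacent (suc i) zero    zero    ()
punchIn-reflects-adjacent (suc i) zero    (suc d) eq = cong suc (punchIn≡0 (ℕ.suc-injective eq))
  where
  punchIn≡0 : ∀ {i : Fin (suc _)} {d} → toℕ (punchIn i d) ≡ 0 → toℕ d ≡ 0
  punchIn≡0 {zero}  ()
  punchIn≡0 {suc i} {zero} _ = ≡.refl
punchIn-reflects-adjacent (suc i) (suc c) zero    ()
punchIn-reflects-adjacent (suc i) (suc c) (suc d) eq =
  cong suc (punchIn-reflects-adjacent i c d (ℕ.suc-injective eq))

punchOut-adjacent : ∀ {i j k : Fin (suc n)} (i≢j : i ≢ j) (i≢k : i ≢ k) →
                    toℕ k ≡ suc (toℕ j) → toℕ (punchOut i≢k) ≡ suc (toℕ (punchOut i≢j))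
punchOut-adjacent {i = i} i≢j i≢k k≡1+j = punchIn-reflects-adjacent i (punchOut i≢j) (punchOut i≢k)
  (≡.subst₂ (λ k′ j′ → toℕ k′ ≡ suc (toℕ j′))
             (≡.sym (punchIn-punchOut i≢k)) (≡.sym (punchIn-punchOut i≢j)) k≡1+j)

module _ {c ℓ} (F : Field c ℓ) where
  open Field F hiding (zero)
  open FieldOps F
  open import Relation.Binary.Reasoning.Setoid setoid
  open import Algebra.Properties.Ring ring using (-‿distribˡ-*; -‿distribʳ-*; -1*x≈-x; [y-z]x≈yx-zx)
  open import Algebra.Properties.Group +-group using (inverseʳ-unique; ⁻¹-involutive; x∙y⁻¹≈ε⇒x≈y)
  open import Algebra.Properties.AbelianGroup +-abelianGroup using (⁻¹-anti-homo‿-)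
  open import Data.List.Relation.Binary.Permutation.Setoid.Properties setoid using (↭-reverse; foldr-commMonoid)
  open import Algebra.Properties.Semiring.Sum semiring
    using (sum-cong-≋; ∑-distrib-+; *-distribˡ-sum; *-distribʳ-sum; sum-remove; sum-replicate-zero)
    renaming (sum to ∑)
  open import Algebra.Properties.CommutativeMonoid.Sum *-commutativeMonoid
    using () renaming ( sum to ∏; ∑-distrib-+ to prod-distrib; sum-cong-≋ to prod-cong
                      ; sum-remove to prod-remove; sum-replicate-zero to prod-ones)
  open import Algebra.Solver.Ring.NaturalCoefficients.Default commutativeSemiring using (solve; _:+_; _:*_; _:=_)

  -- Finite sums and products

  ΣF≡∑ : (g : Fin n → Carrier) → ΣF g ≡ ∑ g
  ΣF≡∑ {zero}  g = ≡.refl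
  ΣF≡∑ {suc n} g = cong (g zero +_) (ΣF≡∑ (g ∘ suc))

  ΠF≡∏ : (g : Fin n → Carrier) → ΠF g ≡ ∏ g
  ΠF≡∏ {zero}  g = ≡.refl
  ΠF≡∏ {suc n} g = cong (g zero *_) (ΠF≡∏ (g ∘ suc))

  ∑-zero : (g : Fin n → Carrier) → (∀ k → g k ≈ 0#) → ∑ g ≈ 0#
  ∑-zero {n} g g≈0 = trans (sum-cong-≋ g≈0) (sum-replicate-zero n)

  ∏-ones : (g : Fin n → Carrier) → (∀ k → g k ≈ 1#) → ∏ g ≈ 1#
  ∏-ones {n} g g≈1 = trans (prod-cong g≈1) (prod-ones n)

  ∏-update : (g h : Fin n → Carrier) (p : Fin n) → (∀ k → k ≢ p → g k ≈ h k) → h p ≈ 1# → ∏ g ≈ ∏ h * g p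
  ∏-update {suc n} g h p g≈h hp≈1 = begin
    ∏ g                             ≈⟨ prod-remove g ⟩
    g p * ∏ (removeAt g p)          ≈⟨ *-congˡ (prod-cong (λ k → g≈h (punchIn p k) (punchInᵢ≢i p k))) ⟩
    g p * ∏ (removeAt h p)          ≈⟨ *-congˡ (sym (*-identityˡ _)) ⟩
    g p * (1# * ∏ (removeAt h p))   ≈⟨ *-congˡ (*-congʳ (sym hp≈1)) ⟩
    g p * (h p * ∏ (removeAt h p))  ≈⟨ *-congˡ (sym (prod-remove h)) ⟩
    g p * ∏ h                       ≈⟨ *-comm _ _ ⟩
    ∏ h * g p                       ∎

  ∑-single : (g : Fin n → Carrier) (p : Fin n) → (∀ k → k ≢ p → g k ≈ 0#) → ∑ g ≈ g p
  ∑-single {suc n} g p g≈0 = begin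
    ∑ g                       ≈⟨ sum-remove g ⟩
    g p + ∑ (removeAt g p)    ≈⟨ +-congˡ (∑-zero _ (λ k → g≈0 (punchIn p k) (punchInᵢ≢i p k))) ⟩
    g p + 0#                  ≈⟨ +-identityʳ (g p) ⟩
    g p                       ∎

  ∑-pair : (g : Fin (suc n) → Carrier) {p q : Fin (suc n)} → p ≢ q →
           (∀ k → k ≢ p → k ≢ q → g k ≈ 0#) → ∑ g ≈ g p + g q
  ∑-pair g {p} {q} p≢q g≈0 = begin
    ∑ g                            ≈⟨ sum-remove g ⟩
    g p + ∑ (removeAt g p)         ≈⟨ +-congˡ (∑-single (removeAt g p) q′ others) ⟩
    g p + g (punchIn p q′)         ≡⟨ cong (λ k → g p + g k) (punchIn-punchOut p≢q) ⟩
    g p + g q                      ∎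
    where
    q′ = punchOut p≢q
    others : ∀ k → k ≢ q′ → g (punchIn p k) ≈ 0#
    others k k≢q′ = g≈0 (punchIn p k) (punchInᵢ≢i p k) (punchIn-≢ p≢q k k≢q′)

  ∑-neg : (g : Fin n → Carrier) → ∑ (λ k → - g k) ≈ - ∑ g
  ∑-neg g = begin
    ∑ (λ k → - g k)         ≈⟨ sum-cong-≋ (λ k → sym (-1*x≈-x (g k))) ⟩
    ∑ (λ k → - 1# * g k)    ≈⟨ sym (*-distribˡ-sum (- 1#) g) ⟩
    - 1# * ∑ g              ≈⟨ -1*x≈-x (∑ g) ⟩
    - ∑ g                   ∎

  ∑-difference : (f g : Fin n → Carrier) → ∑ (λ k → f k - g k) ≈ ∑ f - ∑ g
  ∑-difference f g = trans (∑-distrib-+ f (λ k → - g k)) (+-congˡ (∑-neg g))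

  -x*-y≈x*y : ∀ x y → - x * - y ≈ x * y
  -x*-y≈x*y x y = begin
    - x * - y        ≈⟨ sym (-‿distribˡ-* x (- y)) ⟩
    - (x * - y)      ≈⟨ -‿cong (sym (-‿distribʳ-* x y)) ⟩
    - - (x * y)      ≈⟨ ⁻¹-involutive (x * y) ⟩
    x * y            ∎

  /-intro : ∀ {x y z} → y ≉ 0# → x * y ≈ z → x ≈ z / y
  /-intro {x} {y} {z} y≉0 xy≈z = begin
    x                 ≈⟨ sym (*-identityʳ x) ⟩
    x * 1#            ≈⟨ *-congˡ (sym (⁻¹-inverse y y≉0)) ⟩
    x * (y * y ⁻¹)    ≈⟨ sym (*-assoc x y (y ⁻¹)) ⟩
    x * y * y ⁻¹      ≈⟨ *-congʳ xy≈z ⟩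
    z / y             ∎

  listProduct : List Carrier → Carrier
  listProduct = List.foldr _*_ 1#

  -- Determinants

  signed≈* : ∀ k x → signed k x ≈ signed k 1# * x
  signed≈* zero    x = sym (*-identityˡ x)
  signed≈* (suc k) x = trans (-‿cong (signed≈* k x)) (-‿distribˡ-* (signed k 1#) x)

  signed-cong : ∀ k {x y} → x ≈ y → signed k x ≈ signed k y
  signed-cong zero    x≈y = x≈y
  signed-cong (suc k) x≈y = -‿cong (signed-cong k x≈y)

  signed-linear : ∀ k x y u v → signed k (x * u + y * v) ≈ x * signed k u + y * signed k v
  signed-linear k x y u v = begin
    signed k (x * u + y * v)                ≈⟨ signed≈* k _ ⟩
    s * (x * u + y * v)
      ≈⟨ solve 5 (λ s x y u v → s :* (x :* u :+ y :* v) := (x :* (s :* u) :+ y :* (s :* v))) refl s x y u v ⟩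
    x * (s * u) + y * (s * v)               ≈⟨ sym (+-cong (*-congˡ (signed≈* k u)) (*-congˡ (signed≈* k v))) ⟩
    x * signed k u + y * signed k v         ∎
    where s = signed k 1#

  Matrix : ℕ → Set c
  Matrix n = Fin n → Fin n → Carrier

  minor : Matrix (suc n) → Fin (suc n) → Matrix n
  minor M j i k = M (suc i) (punchIn j k)

  term : Matrix (suc n) → Fin (suc n) → Carrier
  term {n} M j = signed (toℕ j) (M zero j * det n (minor M j))

  det-expand : (M : Matrix (suc n)) → det (suc n) M ≡ ∑ (term M)
  det-expand M = ΣF≡∑ (term M)

  det-cong : ∀ n {M N : Matrix n} → (∀ i j → M i j ≈ N i j) → det n M ≈ det n N
  det-cong zero    M≈N = refl
  det-cong (suc n) {M} {N} M≈N = begin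
    det (suc n) M  ≡⟨ det-expand M ⟩
    ∑ (term M)     ≈⟨ sum-cong-≋ (λ j → signed-cong (toℕ j)
                        (*-cong (M≈N zero j) (det-cong n (λ i k → M≈N (suc i) (punchIn j k))))) ⟩
    ∑ (term N)     ≡⟨ ≡.sym (det-expand N) ⟩
    det (suc n) N  ∎

  det-minor-cong : ∀ n (M N : Matrix (suc n)) j → (∀ i k → k ≢ j → M i k ≈ N i k) →
                   det n (minor M j) ≈ det n (minor N j)
  det-minor-cong n M N j M≈N = det-cong n (λ i k → M≈N (suc i) (punchIn j k) (punchInᵢ≢i j k))

  det-linear : ∀ n (p : Fin n) x y (M A B : Matrix n) →
               (∀ i k → k ≢ p → A i k ≈ M i k) → (∀ i k → k ≢ p → B i k ≈ M i k) →
               (∀ i → M i p ≈ x * A i p + y * B i p) →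
               det n M ≈ x * det n A + y * det n B
  det-linear (suc n) p x y M A B A≈M B≈M Mp≈ = begin
    det (suc n) M                                    ≡⟨ det-expand M ⟩
    ∑ (term M)                                       ≈⟨ sum-cong-≋ term-linear ⟩
    ∑ (λ j → x * term A j + y * term B j)            ≈⟨ ∑-distrib-+ (λ j → x * term A j) (λ j → y * term B j) ⟩
    ∑ (λ j → x * term A j) + ∑ (λ j → y * term B j)  ≈⟨ sym (+-cong (*-distribˡ-sum x (term A))
                                                                     (*-distribˡ-sum y (term B))) ⟩
    x * ∑ (term A) + y * ∑ (term B)                  ≡⟨ ≡.cong₂ (λ u v → x * u + y * v)
                                                                (≡.sym (det-expand A)) (≡.sym (det-expand B)) ⟩
    x * det (suc n) A + y * det (suc n) B            ∎
    where
    term-linear : ∀ j → term M j ≈ x * term A j + y * term B j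
    term-linear j = trans (signed-cong (toℕ j) (entry-linear (j ≟ p))) (signed-linear (toℕ j) x y _ _)
      where
      a = A zero j
      b = B zero j
      dA = det n (minor A j)
      dB = det n (minor B j)
      entry-linear : Dec (j ≡ p) → M zero j * det n (minor M j) ≈ x * (a * dA) + y * (b * dB)
      entry-linear (yes ≡.refl) = begin
        M zero j * det n (minor M j)
          ≈⟨ *-cong (Mp≈ zero) (det-minor-cong n M A j (λ i k k≢j → sym (A≈M i k k≢j))) ⟩
        (x * a + y * b) * dA
          ≈⟨ solve 5 (λ x y a b d → (x :* a :+ y :* b) :* d := (x :* (a :* d) :+ y :* (b :* d))) refl x y a b dA ⟩
        x * (a * dA) + y * (b * dA)
          ≈⟨ +-congˡ (*-congˡ (*-congˡ (det-minor-cong n A B j (λ i k k≢j → trans (A≈M i k k≢j) (sym (B≈M i k k≢j)))))) ⟩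
        x * (a * dA) + y * (b * dB) ∎
      entry-linear (no j≢p) = begin
        M zero j * det n (minor M j)
          ≈⟨ *-congˡ (det-linear n p′ x y (minor M j) (minor A j) (minor B j)
                        (λ i k k≢p′ → A≈M (suc i) (punchIn j k) (punchIn-≢ j≢p k k≢p′))
                        (λ i k k≢p′ → B≈M (suc i) (punchIn j k) (punchIn-≢ j≢p k k≢p′))
                        minor-p′) ⟩
        M zero j * (x * dA + y * dB)
          ≈⟨ solve 5 (λ m x y a b → m :* (x :* a :+ y :* b) := (x :* (m :* a) :+ y :* (m :* b))) refl (M zero j) x y dA dB ⟩
        x * (M zero j * dA) + y * (M zero j * dB)
          ≈⟨ +-cong (*-congˡ (*-congʳ (sym (A≈M zero j j≢p)))) (*-congˡ (*-congʳ (sym (B≈M zero j j≢p)))) ⟩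
        x * (a * dA) + y * (b * dB) ∎
        where
        p′ = punchOut j≢p
        minor-p′ : ∀ i → minor M j i p′ ≈ x * minor A j i p′ + y * minor B j i p′
        minor-p′ i rewrite punchIn-punchOut j≢p = Mp≈ (suc i)

  det-additive : ∀ n (p : Fin n) (M A B : Matrix n) →
                 (∀ i k → k ≢ p → A i k ≈ M i k) → (∀ i k → k ≢ p → B i k ≈ M i k) →
                 (∀ i → M i p ≈ A i p + B i p) → det n M ≈ det n A + det n B
  det-additive n p M A B A≈M B≈M Mp≈ = begin
    det n M                      ≈⟨ det-linear n p 1# 1# M A B A≈M B≈M
                                      (λ i → trans (Mp≈ i) (sym (+-cong (*-identityˡ _) (*-identityˡ _)))) ⟩
    1# * det n A + 1# * det n B  ≈⟨ +-cong (*-identityˡ _) (*-identityˡ _) ⟩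
    det n A + det n B            ∎

  setCol : Matrix n → Fin n → (Fin n → Carrier) → Matrix n
  setCol M p v i k with k ≟ p
  ... | yes _ = v i
  ... | no  _ = M i k

  setCol-≡ : ∀ (M : Matrix n) p v i → setCol M p v i p ≈ v i
  setCol-≡ M p v i with p ≟ p
  ... | yes _   = refl
  ... | no  p≢p = ⊥-elim (p≢p ≡.refl)

  setCol-≢ : ∀ (M : Matrix n) p v i k → k ≢ p → setCol M p v i k ≈ M i k
  setCol-≢ M p v i k k≢p with k ≟ p
  ... | yes k≡p = ⊥-elim (k≢p k≡p)
  ... | no  _   = refl

  setCol-cong : ∀ {M N : Matrix n} p v i k → M i k ≈ N i k → setCol M p v i k ≈ setCol N p v i k
  setCol-cong p v i k Mik≈Nik with k ≟ p
  ... | yes _ = refl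
  ... | no  _ = Mik≈Nik

  setCol-setCol : ∀ (M : Matrix n) p v w i k → setCol (setCol M p v) p w i k ≈ setCol M p w i k
  setCol-setCol M p v w i k with k ≟ p
  ... | yes _   = refl
  ... | no  k≢p = setCol-≢ M p v i k k≢p

  setCol-self : ∀ (M : Matrix n) p i k → setCol M p (λ i → M i p) i k ≈ M i k
  setCol-self M p i k with k ≟ p
  ... | yes ≡.refl = refl
  ... | no  _      = refl

  det-∑-column : ∀ n p (M : Matrix n) {m} (cs : Fin m → Carrier) (vs : Fin m → Fin n → Carrier) →
                 (∀ i → M i p ≈ ∑ (λ k → cs k * vs k i)) →
                 det n M ≈ ∑ (λ k → cs k * det n (setCol M p (vs k)))
  det-∑-column n p M {zero} cs vs Mp≈0 = begin
    det n M                      ≈⟨ det-linear n p 0# 0# M M M (λ _ _ _ → refl) (λ _ _ _ → refl)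
                                      (λ i → trans (Mp≈0 i) (sym (trans (+-cong (zeroˡ _) (zeroˡ _)) (+-identityʳ 0#)))) ⟩
    0# * det n M + 0# * det n M  ≈⟨ trans (+-cong (zeroˡ _) (zeroˡ _)) (+-identityʳ 0#) ⟩
    0#                           ∎
  det-∑-column n p M {suc m} cs vs Mp≈ = begin
    det n M
      ≈⟨ det-linear n p (cs zero) 1# M (setCol M p (vs zero)) B
           (λ i k k≢p → setCol-≢ M p _ i k k≢p) (λ i k k≢p → setCol-≢ M p _ i k k≢p)
           (λ i → trans (Mp≈ i) (+-cong (*-congˡ (sym (setCol-≡ M p _ i)))
                                         (trans (sym (*-identityˡ _)) (*-congˡ (sym (setCol-≡ M p _ i)))))) ⟩
    cs zero * det n (setCol M p (vs zero)) + 1# * det n B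
      ≈⟨ +-congˡ (trans (*-identityˡ _) (det-∑-column n p B (cs ∘ suc) (vs ∘ suc) (setCol-≡ M p rest))) ⟩
    cs zero * det n (setCol M p (vs zero)) + ∑ (λ k → cs (suc k) * det n (setCol B p (vs (suc k))))
      ≈⟨ +-congˡ (sum-cong-≋ (λ k → *-congˡ (det-cong n (setCol-setCol M p rest (vs (suc k)))))) ⟩
    ∑ (λ k → cs k * det n (setCol M p (vs k))) ∎
    where
    rest : Fin n → Carrier
    rest i = ∑ (λ k → cs (suc k) * vs (suc k) i)
    B = setCol M p rest

  signed-0 : ∀ k {x} → x ≈ 0# → signed k x ≈ 0#
  signed-0 k x≈0 = trans (signed≈* k _) (trans (*-congˡ x≈0) (zeroʳ _))

  det-adjacent-columns : ∀ n (M : Matrix n) j k → toℕ k ≡ suc (toℕ j) →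
                         (∀ i → M i j ≈ M i k) → det n M ≈ 0#
  det-adjacent-columns (suc n) M j k k≡1+j Mj≈Mk = begin
    det (suc n) M          ≡⟨ det-expand M ⟩
    ∑ (term M)             ≈⟨ ∑-pair (term M) j≢k others ⟩
    term M j + term M k    ≈⟨ +-congˡ term-k ⟩
    term M j - term M j    ≈⟨ -‿inverseʳ _ ⟩
    0#                     ∎
    where
    j≢k : j ≢ k
    j≢k = Fin.<⇒≢ (≡.subst (toℕ j <_) (≡.sym k≡1+j) (ℕ.n<1+n (toℕ j)))
    minors : ∀ i c → minor M k i c ≈ minor M j i c
    minors i c with punchIn-adjacent k≡1+j c
    ... | inj₁ eq         = reflexive (cong (M (suc i)) (≡.sym eq))
    ... | inj₂ (eqj , eqk) = trans (reflexive (cong (M (suc i)) eqk))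
                               (trans (Mj≈Mk (suc i)) (reflexive (cong (M (suc i)) (≡.sym eqj))))
    term-k : term M k ≈ - term M j
    term-k rewrite k≡1+j = -‿cong (signed-cong (toℕ j) (*-cong (sym (Mj≈Mk zero)) (det-cong n minors)))
    others : ∀ l → l ≢ j → l ≢ k → term M l ≈ 0#
    others l l≢j l≢k = signed-0 (toℕ l) (trans (*-congˡ (det-adjacent-columns n (minor M l) _ _
                         (punchOut-adjacent l≢j l≢k k≡1+j) equal)) (zeroʳ _))
      where
      equal : ∀ i → minor M l i (punchOut l≢j) ≈ minor M l i (punchOut l≢k)
      equal i rewrite punchIn-punchOut l≢j | punchIn-punchOut l≢k = Mj≈Mk (suc i)

  setCol₂ : Matrix n → Fin n → Fin n → (Fin n → Carrier) → (Fin n → Carrier) → Matrix n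
  setCol₂ M p q u v = setCol (setCol M p u) q v

  setCol₂-≡₁ : ∀ (M : Matrix n) {p q} → p ≢ q → ∀ u v i → setCol₂ M p q u v i p ≈ u i
  setCol₂-≡₁ M {p} {q} p≢q u v i = trans (setCol-≢ _ q v i p p≢q) (setCol-≡ M p u i)

  setCol₂-≡₂ : ∀ (M : Matrix n) p q u v i → setCol₂ M p q u v i q ≈ v i
  setCol₂-≡₂ M p q u v i = setCol-≡ _ q v i

  setCol₂-≢ : ∀ (M : Matrix n) p q u v i k → k ≢ p → k ≢ q → setCol₂ M p q u v i k ≈ M i k
  setCol₂-≢ M p q u v i k k≢p k≢q = trans (setCol-≢ _ q v i k k≢q) (setCol-≢ M p u i k k≢p)

  det-antisymmetric : ∀ n (M : Matrix n) {p q} → p ≢ q →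
                      (∀ X → (∀ i → X i p ≈ X i q) → det n X ≈ 0#) →
                      det n (setCol₂ M p q (λ i → M i q) (λ i → M i p)) ≈ - det n M
  det-antisymmetric n M {p} {q} p≢q alternating =
    trans (inverseʳ-unique (D u v) (D v u) split) (-‿cong (det-cong n C-self))
    where
    C = setCol₂ M p q
    D : (Fin n → Carrier) → (Fin n → Carrier) → Carrier
    D x y = det n (C x y)
    u v w : Fin n → Carrier
    u i = M i p
    v i = M i q
    w i = u i + v i
    C-self : ∀ i k → C u v i k ≈ M i k
    C-self i k = trans (setCol-cong q v i k (setCol-self M p i k)) (setCol-self M q i k)
    D-diagonal : ∀ x → D x x ≈ 0#
    D-diagonal x = alternating (C x x) (λ i → trans (setCol₂-≡₁ M p≢q x x i) (sym (setCol₂-≡₂ M p q x x i)))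
    additive₁ : ∀ x y → D (λ i → x i + y i) w ≈ D x w + D y w
    additive₁ x y = det-additive n p _ _ _
      (λ i k k≢p → setCol-cong q w i k (trans (setCol-≢ M p x i k k≢p) (sym (setCol-≢ M p _ i k k≢p))))
      (λ i k k≢p → setCol-cong q w i k (trans (setCol-≢ M p y i k k≢p) (sym (setCol-≢ M p _ i k k≢p))))
      (λ i → trans (setCol₂-≡₁ M p≢q _ w i)
                   (sym (+-cong (setCol₂-≡₁ M p≢q x w i) (setCol₂-≡₁ M p≢q y w i))))
    additive₂ : ∀ x → D x w ≈ D x u + D x v
    additive₂ x = det-additive n q _ _ _
      (λ i k k≢q → trans (setCol-≢ _ q u i k k≢q) (sym (setCol-≢ _ q w i k k≢q)))
      (λ i k k≢q → trans (setCol-≢ _ q v i k k≢q) (sym (setCol-≢ _ q w i k k≢q)))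
      (λ i → trans (setCol₂-≡₂ M p q x w i)
                   (sym (+-cong (setCol₂-≡₂ M p q x u i) (setCol₂-≡₂ M p q x v i))))
    split : D u v + D v u ≈ 0#
    split = begin
      D u v + D v u                            ≈⟨ sym (+-cong (+-identityˡ _) (+-identityʳ _)) ⟩
      (0# + D u v) + (D v u + 0#)              ≈⟨ sym (+-cong (+-congʳ (D-diagonal u)) (+-congˡ (D-diagonal v))) ⟩
      (D u u + D u v) + (D v u + D v v)        ≈⟨ sym (+-cong (additive₂ u) (additive₂ v)) ⟩
      D u w + D v w                            ≈⟨ sym (additive₁ u v) ⟩
      D w w                                    ≈⟨ D-diagonal w ⟩
      0#                                       ∎

  det-equal-columns-at : ∀ d n (M : Matrix n) j k → toℕ k ≡ suc (d ℕ.+ toℕ j) →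
                         (∀ i → M i j ≈ M i k) → det n M ≈ 0#
  det-equal-columns-at zero    n M j k k≡1+j Mj≈Mk = det-adjacent-columns n M j k k≡1+j Mj≈Mk
  det-equal-columns-at (suc d) (suc n) M j (suc k) k≡ Mj≈Mk = begin
    det (suc n) M        ≈⟨ sym (+-identityʳ _) ⟩
    det (suc n) M + 0#   ≈⟨ +-congˡ (trans (sym swapped≈0) swap) ⟩
    det (suc n) M - det (suc n) M   ≈⟨ -‿inverseʳ _ ⟩
    0#                   ∎
    where
    k′ = inject₁ k
    k′≡ : toℕ k′ ≡ suc (d ℕ.+ toℕ j)
    k′≡ = ≡.trans (toℕ-inject₁ k) (ℕ.suc-injective k≡)
    adjacent : toℕ (suc k) ≡ suc (toℕ k′)
    adjacent = cong suc (≡.sym (toℕ-inject₁ k))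
    j<k′ : toℕ j < toℕ k′
    j<k′ = ≡.subst (toℕ j <_) (≡.sym k′≡) (s≤s (ℕ.m≤n+m (toℕ j) d))
    k′<k : toℕ k′ < toℕ (suc k)
    k′<k = ≡.subst (toℕ k′ <_) (≡.sym adjacent) (ℕ.n<1+n (toℕ k′))
    -- swapping columns k′ and k moves the copy of column j one step closer to it
    M′ = setCol₂ M k′ (suc k) (λ i → M i (suc k)) (λ i → M i k′)
    swap : det (suc n) M′ ≈ - det (suc n) M
    swap = det-antisymmetric (suc n) M (Fin.<⇒≢ k′<k)
             (λ X → det-adjacent-columns (suc n) X k′ (suc k) adjacent)
    swapped≈0 : det (suc n) M′ ≈ 0#
    swapped≈0 = det-equal-columns-at d (suc n) M′ j k′ k′≡ λ i →
      trans (setCol₂-≢ M k′ (suc k) _ _ i j (Fin.<⇒≢ j<k′) (Fin.<⇒≢ (ℕ.<-trans j<k′ k′<k)))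
            (trans (Mj≈Mk i) (sym (setCol₂-≡₁ M (Fin.<⇒≢ k′<k) _ _ i)))

  det-equal-columns : ∀ n (M : Matrix n) j k → j ≢ k → (∀ i → M i j ≈ M i k) → det n M ≈ 0#
  det-equal-columns n M j k j≢k Mj≈Mk with Fin.<-cmp j k
  ... | tri< j<k _ _ = let d , eq = ℕ.m≤n⇒∃[o]m+o≡n j<k in
    det-equal-columns-at d n M j k (≡.trans (≡.sym eq) (cong suc (ℕ.+-comm (toℕ j) d))) Mj≈Mk
  ... | tri≈ _ j≡k _ = ⊥-elim (j≢k j≡k)
  ... | tri> _ _ k<j = let d , eq = ℕ.m≤n⇒∃[o]m+o≡n k<j in
    det-equal-columns-at d n M k j (≡.trans (≡.sym eq) (cong suc (ℕ.+-comm (toℕ k) d))) (λ i → sym (Mj≈Mk i))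

  det-eliminate-column : ∀ n (P M T : Matrix n) p →
                         (∀ k → toℕ p < toℕ k → T k p ≈ 0#) →
                         (∀ i k → toℕ k < toℕ p → P i k ≈ M i k) →
                         (∀ i → P i p ≈ ∑ (λ k → T k p * M i k)) →
                         det n P ≈ T p p * det n (setCol P p (λ i → M i p))
  det-eliminate-column n P M T p T-below P-left Pp≈ = begin
    det n P                                                  ≈⟨ det-∑-column n p P (λ k → T k p) (λ k i → M i k) Pp≈ ⟩
    ∑ (λ k → T k p * det n (setCol P p (λ i → M i k)))       ≈⟨ ∑-single _ p only-p ⟩
    T p p * det n (setCol P p (λ i → M i p))                 ∎
    where
    only-p : ∀ k → k ≢ p → T k p * det n (setCol P p (λ i → M i k)) ≈ 0#
    only-p k k≢p with Fin.<-cmp k p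
    ... | tri< k<p _ _ = trans (*-congˡ (det-equal-columns n (setCol P p (λ i → M i k)) k p k≢p (λ i →
            trans (setCol-≢ P p _ i k k≢p) (trans (P-left i k k<p) (sym (setCol-≡ P p _ i))))))
          (zeroʳ _)
    ... | tri≈ _ k≡p _ = ⊥-elim (k≢p k≡p)
    ... | tri> _ _ p<k = trans (*-congʳ (T-below k p<k)) (zeroˡ _)

  det-triangular-transform : ∀ n (M N T : Matrix n) →
                             (∀ k j → toℕ j < toℕ k → T k j ≈ 0#) →
                             (∀ i j → N i j ≈ ∑ (λ k → T k j * M i k)) →
                             det n N ≈ ∏ (λ j → T j j) * det n M
  det-triangular-transform zero M N T _ _ = sym (*-identityˡ 1#)
  det-triangular-transform n@(suc _) M N T T-upper N≈MT = begin
    det n N                   ≈⟨ replaced n ℕ.≤-refl ⟩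
    Π-prefix n * det n (P n)  ≈⟨ *-cong (prod-cong (λ j → diagonal-below n j (Fin.toℕ<n j)))
                                        (det-cong n (λ i j → P-below n i j (Fin.toℕ<n j))) ⟩
    ∏ (λ j → T j j) * det n M ∎
    where
    -- P m takes its first m columns from M and the others from N; eliminating its
    -- column m turns it into P (suc m) at the cost of the factor T m m.
    P : ℕ → Matrix n
    P m i j = if toℕ j <ᵇ m then M i j else N i j
    P-below : ∀ m i j → toℕ j < m → P m i j ≈ M i j
    P-below m i j j<m = reflexive (if-<ᵇ-true j<m)
    P-above : ∀ m i j → ¬ toℕ j < m → P m i j ≈ N i j
    P-above m i j j≮m = reflexive (if-<ᵇ-false j≮m)
    diagonal-prefix : ℕ → Fin n → Carrier
    diagonal-prefix m j = if toℕ j <ᵇ m then T j j else 1#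
    diagonal-below : ∀ m j → toℕ j < m → diagonal-prefix m j ≈ T j j
    diagonal-below m j j<m = reflexive (if-<ᵇ-true j<m)
    diagonal-above : ∀ m j → ¬ toℕ j < m → diagonal-prefix m j ≈ 1#
    diagonal-above m j j≮m = reflexive (if-<ᵇ-false j≮m)
    Π-prefix : ℕ → Carrier
    Π-prefix m = ∏ (diagonal-prefix m)
    replaced : ∀ m → m ≤ n → det n N ≈ Π-prefix m * det n (P m)
    replaced zero _ = begin
      det n N                  ≈⟨ det-cong n (λ i j → sym (P-above 0 i j (λ ()))) ⟩
      det n (P 0)              ≈⟨ sym (*-identityˡ _) ⟩
      1# * det n (P 0)         ≈⟨ *-congʳ (sym (∏-ones (diagonal-prefix 0) (λ j → diagonal-above 0 j (λ ())))) ⟩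
      Π-prefix 0 * det n (P 0) ∎
    replaced (suc m) m<n = begin
      det n N                                  ≈⟨ replaced m (ℕ.<⇒≤ m<n) ⟩
      Π-prefix m * det n (P m)                 ≈⟨ *-congˡ (det-eliminate-column n (P m) M T p
                                                     (λ k → T-upper k p)
                                                     (λ i k k<p → P-below m i k (≡.subst (toℕ k <_) p≡m k<p))
                                                     (λ i → trans (P-above m i p p≮m) (N≈MT i p))) ⟩
      Π-prefix m * (T p p * det n (setCol (P m) p (λ i → M i p)))
                                               ≈⟨ *-congˡ (*-congˡ (det-cong n next-prefix)) ⟩
      Π-prefix m * (T p p * det n (P (suc m))) ≈⟨ sym (*-assoc _ _ _) ⟩
      Π-prefix m * T p p * det n (P (suc m))   ≈⟨ *-congʳ (sym prefix-step) ⟩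
      Π-prefix (suc m) * det n (P (suc m))     ∎
      where
      p = fromℕ< m<n
      p≡m : toℕ p ≡ m
      p≡m = Fin.toℕ-fromℕ< m<n
      p≮m : ¬ toℕ p < m
      p≮m = ℕ.<-irrefl p≡m
      p<1+m : toℕ p < suc m
      p<1+m = ≡.subst (_< suc m) (≡.sym p≡m) (ℕ.n<1+n m)
      ≢p⇒≢m : ∀ {k} → k ≢ p → toℕ k ≢ m
      ≢p⇒≢m k≢p eq = k≢p (toℕ-injective (≡.trans eq (≡.sym p≡m)))
      next-prefix : ∀ i k → setCol (P m) p (λ i → M i p) i k ≈ P (suc m) i k
      next-prefix i k with k ≟ p
      ... | yes ≡.refl = sym (P-below (suc m) i p p<1+m)
      ... | no  k≢p    = reflexive (if-<ᵇ-suc (≢p⇒≢m k≢p))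
      prefix-step : Π-prefix (suc m) ≈ Π-prefix m * T p p
      prefix-step = trans (∏-update (diagonal-prefix (suc m)) (diagonal-prefix m) p (λ k k≢p → reflexive (≡.sym (if-<ᵇ-suc (≢p⇒≢m k≢p))))
                                        (diagonal-above m p p≮m))
                          (*-congˡ (diagonal-below (suc m) p p<1+m))

  -- Divided differences

  module DividedDifferences (a : Fin n → Carrier) where

    δ : Fin n → Fin n → Carrier
    δ k y with k ≟ y
    ... | yes _ = 1#
    ... | no  _ = 0#

    δ-refl : ∀ y → δ y y ≈ 1#
    δ-refl y with y ≟ y
    ... | yes _   = refl
    ... | no  y≢y = ⊥-elim (y≢y ≡.refl)

    δ-≢ : ∀ {k y} → k ≢ y → δ k y ≈ 0#
    δ-≢ {k} {y} k≢y with k ≟ y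
    ... | yes k≡y = ⊥-elim (k≢y k≡y)
    ... | no  _   = refl

    coefficient : Fin n → List (Fin n) → Fin n → Carrier
    coefficient y []         k = δ k y
    coefficient y (x ∷ rest) k = (coefficient x rest k - coefficient y rest k) / (a x - a y)

    dd-expansion : ∀ (g : Carrier → Carrier) y ks →
                   dd g (a y) (List.map a ks) ≈ ∑ (λ k → coefficient y ks k * g (a k))
    dd-expansion g y [] = sym (begin
      ∑ (λ k → δ k y * g (a k))   ≈⟨ ∑-single _ y (λ k k≢y → trans (*-congʳ (δ-≢ k≢y)) (zeroˡ _)) ⟩
      δ y y * g (a y)             ≈⟨ trans (*-congʳ (δ-refl y)) (*-identityˡ _) ⟩
      g (a y)                     ∎)
    dd-expansion g y (x ∷ rest) = begin
      (dd g (a x) (List.map a rest) - dd g (a y) (List.map a rest)) * w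
        ≈⟨ *-congʳ (+-cong (dd-expansion g x rest) (-‿cong (dd-expansion g y rest))) ⟩
      (∑ (λ k → A k * G k) - ∑ (λ k → B k * G k)) * w
        ≈⟨ *-congʳ (sym (∑-difference (λ k → A k * G k) (λ k → B k * G k))) ⟩
      ∑ (λ k → A k * G k - B k * G k) * w
        ≈⟨ *-distribʳ-sum w (λ k → A k * G k - B k * G k) ⟩
      ∑ (λ k → (A k * G k - B k * G k) * w)
        ≈⟨ sum-cong-≋ (λ k → trans (*-congʳ (sym ([y-z]x≈yx-zx (G k) (A k) (B k))))
                                 (solve 3 (λ d g w → d :* g :* w := d :* w :* g) refl (A k - B k) (G k) w)) ⟩
      ∑ (λ k → (A k - B k) * w * G k)   ∎
      where
      w = (a x - a y) ⁻¹
      A = coefficient x rest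
      B = coefficient y rest
      G = λ k → g (a k)

    coefficient-outside : ∀ {k} y ks → k ≢ y → k ∉ ks → coefficient y ks k ≈ 0#
    coefficient-outside y []         k≢y _  = δ-≢ k≢y
    coefficient-outside y (x ∷ rest) k≢y k∉ = begin
      (coefficient x rest _ - coefficient y rest _) / (a x - a y)
        ≈⟨ *-congʳ (+-cong (coefficient-outside x rest (k∉ ∘ here) (k∉ ∘ there))
                           (-‿cong (coefficient-outside y rest k≢y (k∉ ∘ there)))) ⟩
      (0# - 0#) / (a x - a y)   ≈⟨ *-congʳ (-‿inverseʳ 0#) ⟩
      0# * (a x - a y) ⁻¹       ≈⟨ zeroˡ _ ⟩
      0#                        ∎

    nodeProduct : Fin n → List (Fin n) → Carrier
    nodeProduct y ks = listProduct (List.map (λ k → a y - a k) ks)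

    coefficient-diagonal : (∀ i j → a i ≈ a j → i ≡ j) → ∀ y ks → y ∉ ks →
                           coefficient y ks y * nodeProduct y ks ≈ 1#
    coefficient-diagonal _ y [] _ = trans (*-congʳ (δ-refl y)) (*-identityˡ 1#)
    coefficient-diagonal a-injective y (x ∷ rest) y∉ = begin
      (coefficient x rest y - cy) * w * ((a y - a x) * P)
        ≈⟨ *-cong (*-congʳ (trans (+-congʳ (coefficient-outside x rest (y∉ ∘ here) (y∉ ∘ there)))
                                  (+-identityˡ _)))
                  (*-congʳ (sym (⁻¹-anti-homo‿- (a x) (a y)))) ⟩
      - cy * w * (- D * P)     ≈⟨ sym (*-cong (-‿distribˡ-* cy w) (-‿distribˡ-* D P)) ⟩
      - (cy * w) * - (D * P)   ≈⟨ -x*-y≈x*y (cy * w) (D * P) ⟩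
      cy * w * (D * P)         ≈⟨ solve 4 (λ c w d p → c :* w :* (d :* p) := c :* p :* (d :* w)) refl cy w D P ⟩
      cy * P * (D * w)         ≈⟨ *-cong (coefficient-diagonal a-injective y rest (y∉ ∘ there))
                                         (⁻¹-inverse D D≉0) ⟩
      1# * 1#                  ≈⟨ *-identityˡ 1# ⟩
      1#                       ∎
      where
      cy = coefficient y rest y
      P = nodeProduct y rest
      D = a x - a y
      w = D ⁻¹
      D≉0 : D ≉ 0#
      D≉0 D≈0 = y∉ (here (≡.sym (a-injective x y (x∙y⁻¹≈ε⇒x≈y (a x) (a y) D≈0))))

    module PrecedingNodes (a-injective : ∀ i j → a i ≈ a j → i ≡ j) (ks : Fin n → List (Fin n))
                          (ks-precede : ∀ j k → k ∈ ks j → toℕ k < toℕ j) where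

      nodeProducts : Carrier
      nodeProducts = ∏ (λ j → nodeProduct j (ks j))

      ∉-own-nodes : ∀ j → j ∉ ks j
      ∉-own-nodes j j∈ = ℕ.<-irrefl ≡.refl (ks-precede j j j∈)

      diagonal-inverse : ∏ (λ j → coefficient j (ks j) j) * nodeProducts ≈ 1#
      diagonal-inverse = begin
        ∏ (λ j → coefficient j (ks j) j) * nodeProducts
          ≈⟨ sym (prod-distrib (λ j → coefficient j (ks j) j) (λ j → nodeProduct j (ks j))) ⟩
        ∏ (λ j → coefficient j (ks j) j * nodeProduct j (ks j))
          ≈⟨ ∏-ones _ (λ j → coefficient-diagonal a-injective j (ks j) (∉-own-nodes j)) ⟩
        1#             ∎

      nodeProducts-≉0 : nodeProducts ≉ 0#
      nodeProducts-≉0 V≈0 = 0≉1 (begin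
        0#                                              ≈⟨ sym (zeroʳ _) ⟩
        ∏ (λ j → coefficient j (ks j) j) * 0#           ≈⟨ *-congˡ (sym V≈0) ⟩
        ∏ (λ j → coefficient j (ks j) j) * nodeProducts ≈⟨ diagonal-inverse ⟩
        1#                                              ∎)

      det-dividedDifferences : (g : Fin n → Carrier → Carrier) →
        det n (λ i j → dd (g i) (a j) (List.map a (ks j))) * nodeProducts ≈ det n (λ i j → g i (a j))
      det-dividedDifferences g = begin
        det n (λ i j → dd (g i) (a j) (List.map a (ks j))) * nodeProducts
          ≈⟨ *-congʳ (det-triangular-transform n M _ T T-upper (λ i j → dd-expansion (g i) j (ks j))) ⟩
        ∏ (λ j → T j j) * det n M * nodeProducts
          ≈⟨ solve 3 (λ t d v → t :* d :* v := d :* (t :* v)) refl (∏ (λ j → T j j)) (det n M) nodeProducts ⟩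
        det n M * (∏ (λ j → T j j) * nodeProducts) ≈⟨ *-congˡ diagonal-inverse ⟩
        det n M * 1#                               ≈⟨ *-identityʳ _ ⟩
        det n M                                    ∎
        where
        M : Matrix n
        M i j = g i (a j)
        T : Matrix n
        T k j = coefficient j (ks j) k
        T-upper : ∀ k j → toℕ j < toℕ k → T k j ≈ 0#
        T-upper k j j<k = coefficient-outside j (ks j) (Fin.<⇒≢ j<k ∘ ≡.sym)
                                                        (λ k∈ → ℕ.<-asym j<k (ks-precede j k k∈))

  -- Block structure

  listProduct-map-filter : ∀ {A : Set} (Q : A → Bool) (h : A → Carrier) xs →
    listProduct (List.map h (List.filterᵇ Q xs)) ≈ listProduct (List.map (λ x → if Q x then h x else 1#) xs)
  listProduct-map-filter Q h []       = refl
  listProduct-map-filter Q h (x ∷ xs) with Q x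
  ... | true  = *-congˡ (listProduct-map-filter Q h xs)
  ... | false = trans (listProduct-map-filter Q h xs) (sym (*-identityˡ _))

  listProduct-map-reverse : ∀ {A : Set} (h : A → Carrier) xs →
    listProduct (List.map h (List.reverse xs)) ≈ listProduct (List.map h xs)
  listProduct-map-reverse h xs = begin
    listProduct (List.map h (List.reverse xs))  ≡⟨ cong listProduct (List.reverse-map h xs) ⟩
    listProduct (List.reverse (List.map h xs))  ≈⟨ foldr-commMonoid *-isCommutativeMonoid (↭-reverse (List.map h xs)) ⟩
    listProduct (List.map h xs)                 ∎

  listProduct-map-allFin : (h : Fin n → Carrier) → listProduct (List.map h (List.allFin n)) ≡ ∏ h
  listProduct-map-allFin {n} h = ≡.trans (cong listProduct (List.map-tabulate (λ i → i) h)) (tabulate h)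
    where
    tabulate : ∀ {m} (h : Fin m → Carrier) → listProduct (List.tabulate h) ≡ ∏ h
    tabulate {zero}  h = ≡.refl
    tabulate {suc m} h = cong (h zero *_) (tabulate (h ∘ suc))

  inBlock : (ℕ → ℕ) → Fin n → Fin n → Bool
  inBlock s j k = (s (toℕ j) ≤ᵇ toℕ k) ∧ (toℕ k <ᵇ toℕ j)

  blockNodes : (ℕ → ℕ) → Fin n → List (Fin n)
  blockNodes {n} s j = List.reverse (List.filterᵇ (inBlock s j) (List.allFin n))

  blockNodes-precede : ∀ (s : ℕ → ℕ) (j k : Fin n) → k ∈ blockNodes s j → toℕ k < toℕ j
  blockNodes-precede s j k k∈ with ∈-filter⁻ (T? ∘ inBlock s j) {xs = List.allFin _} (Any.reverse⁻ k∈)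
  ... | _ , k-in-block = ℕ.<ᵇ⇒< (toℕ k) (toℕ j) (proj₂ (Equivalence.to T-∧ k-in-block))

  blockVandermonde≈nodeProducts : ∀ (s : ℕ → ℕ) (a : Fin n → Carrier) →
    ΠF (λ j → ΠF (λ i → if (toℕ i <ᵇ toℕ j) ∧ (s (toℕ j) ≤ᵇ toℕ i) then a j - a i else 1#))
      ≈ ∏ (λ j → DividedDifferences.nodeProduct a j (blockNodes s j))
  blockVandermonde≈nodeProducts {n} s a = trans (reflexive (ΠF≡∏ (λ j → ΠF (factor j)))) (prod-cong column)
    where
    h : Fin n → Fin n → Carrier
    h j i = a j - a i
    factor : Fin n → Fin n → Carrier
    factor j i = if (toℕ i <ᵇ toℕ j) ∧ (s (toℕ j) ≤ᵇ toℕ i) then h j i else 1#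
    column : ∀ j → ΠF (factor j) ≈ DividedDifferences.nodeProduct a j (blockNodes s j)
    column j = begin
      ΠF (factor j)                                ≡⟨ ΠF≡∏ (factor j) ⟩
      ∏ (factor j)                                 ≈⟨ prod-cong (λ i → reflexive (cong (if_then h j i else 1#)
                                                                   (∧-comm (toℕ i <ᵇ toℕ j) (s (toℕ j) ≤ᵇ toℕ i)))) ⟩
      ∏ (λ i → if inBlock s j i then h j i else 1#)
        ≡⟨ ≡.sym (listProduct-map-allFin (λ i → if inBlock s j i then h j i else 1#)) ⟩
      listProduct (List.map (λ i → if inBlock s j i then h j i else 1#) (List.allFin n))
        ≈⟨ sym (listProduct-map-filter (inBlock s j) (h j) (List.allFin n)) ⟩
      listProduct (List.map (h j) (List.filterᵇ (inBlock s j) (List.allFin n)))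
        ≈⟨ sym (listProduct-map-reverse (h j) (List.filterᵇ (inBlock s j) (List.allFin n))) ⟩
      listProduct (List.map (h j) (blockNodes s j)) ∎

  det-blockDividedDifferences : (a : Fin n → Carrier) → (∀ i j → a i ≈ a j → i ≡ j) →
    (g : Fin n → Carrier → Carrier) (s : ℕ → ℕ) →
    det n (λ i j → dd (g i) (a j) (List.map a (blockNodes s j)))
      ≈ det n (λ i j → g i (a j))
        / ΠF (λ j → ΠF (λ i → if (toℕ i <ᵇ toℕ j) ∧ (s (toℕ j) ≤ᵇ toℕ i) then a j - a i else 1#))
  det-blockDividedDifferences a a-injective g s =
    /-intro (λ V≈0 → nodeProducts-≉0 (trans (sym V≈V′) V≈0))
            (trans (*-congˡ V≈V′) (det-dividedDifferences g))
    where
    open DividedDifferences a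
    open PrecedingNodes a-injective (blockNodes s) (blockNodes-precede s)
    V≈V′ = blockVandermonde≈nodeProducts s a

-- The identity holds for arbitrary functions f_i and arbitrary block starts.
lemma22 : ∀ {c₁ ℓ₁ c₂ ℓ₂ : Level} (K : Field c₁ ℓ₁) (L : Field c₂ ℓ₂)
          (φ : Field.Carrier K → Field.Carrier L) →
          RingMorphisms.IsRingHomomorphism (Field.rawRing K) (Field.rawRing L) φ →
          (n : ℕ) (f : Fin n → List (Field.Carrier K)) (a : Fin n → Field.Carrier L) →
          (∀ i j → Field._≈_ L (a i) (a j) → i ≡ j) →
          (ms : List ℕ) → All (1 ≤_) ms → sum ms ≡ n →
          Field._≈_ L
            (FieldOps.det L n (PolyEval.Wblock K L φ n ms f a))
            (Field._/_ L (FieldOps.det L n (PolyEval.Fmat K L φ n f a))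
                         (PolyEval.blockVandermonde K L φ n ms a))
lemma22 K L φ _ n f a a-injective ms _ _ =
  det-blockDividedDifferences L a a-injective (λ i → PolyEval.evalP K L φ (f i)) (blockStart ms)
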